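{- In the satisfaction system of preference statements with hierarchical models, there exist (a choice of variables, domains and operator $\oplus$ and) non-trivial sets of stakeholder statements $\Phi_1,\ldots,\Phi_n\subseteq\mathcal{L}$ that admit at least two middle grounds which are not logically equivalent.
   Context: Let $V$ be a finite set of variables; each $v\in V$ has a finite domain $\underline{v}$ with more than one element; alternatives are elements $\alpha\in\underline{V}=\prod_{v\in V}\underline{v}$, with $\alpha(v)$ the value of $v$. Let $\oplus$ be a commutative, associative operator combining values of any nonempty set of variables, and assume a total order $\geq$ on the domains and on $\oplus$-combinations of values. A hierarchical model is a non-empty sequence $\pi=(Y_1,\ldots,Y_k)$ of non-empty (not necessarily disjoint) subsets of $V$. For alternatives $\alpha,\beta$: $\alpha\succeq_\pi\beta$ iff either $\bigoplus_{y\in Y_i}\alpha(y)=\bigoplus_{y\in Y_i}\beta(y)$ for all $i$, or there is $i$ with $\bigoplus_{y\in Y_i}\alpha(y)>\bigoplus_{y\in Y_i}\beta(y)$ and equality for all $j<i$; $\alpha\succ_\pi\beta$ iff the second condition holds. The language is $\mathcal{L}=\{\alpha\geq\beta\mid\alpha,\beta\in\underline{V}\}\cup\{\alpha>\beta\mid\alpha,\beta\in\underline{V}\}$, with $\pi\models\alpha\geq\beta$ iff $\alpha\succeq_\pi\beta$ and $\pi\models\alpha>\beta$ iff $\alpha\succ_\pi\beta$. For $\Phi\subseteq\mathcal{L}$: $\pi\models\Phi$ iff $\pi$ satisfies every element; $\Phi\models\Phi'$ iff every model of $\Phi$ is a model of $\Phi'$; $\Phi\equiv\Phi'$ iff mutual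 entailment; $\Phi$ is consistent if it has a model, falsifiable if some hierarchical model does not satisfy it, non-trivial if both. Given non-trivial $\Phi_1,\ldots,\Phi_n$, $\Phi\subseteq\mathcal{L}$ is a middle ground if: (P1) $\Phi$ non-trivial; (P2) if $\bigcup_i\Phi_i$ is consistent then $\Phi\equiv\bigcup_i\Phi_i$; (P3) for each $\phi\in\Phi$, each $i$ and each $\phi_i\in\Phi_i$ some model satisfies both $\phi$ and $\phi_i$; (P4) each $\phi\in\Phi$ is entailed by some $\Phi_i$; (P5) no $\Phi'\subseteq\mathcal{L}$ satisfying (P1)–(P4) has $\Phi'\models\Phi$ and $\Phi\not\models\Phi'$. -}

module Defs where

open import Level using (0ℓ)
open import Data.Nat using (ℕ; _≥_)
open import Data.Fin using (Fin; zero; suc)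
open import Data.Fin.Subset using (Subset; Nonempty)
open import Data.Bool using (true; false)
open import Data.Vec using ([]; _∷_)
open import Data.List using (List; []; _∷_; map)
open import Data.List.NonEmpty using (List⁺)
import Data.List.NonEmpty as L⁺
open import Data.Maybe using (Maybe; just; nothing)
open import Data.Product using (Σ; ∃; _×_; _,_)
open import Data.Sum using (_⊎_)
open import Data.Empty using (⊥)
open import Data.Unit using (⊤)
open import Relation.Nullary using (¬_)
open import Relation.Unary using (Pred)
open import Relation.Binary using (Rel; IsStrictTotalOrder)
open import Relation.Binary.PropositionalEquality using (_≡_)

-- Domain values are embedded into the carrier
-- of combinations by `val`; a singleton combination is the value itself, so
-- the order on each domain is the order induced through `val` (injective, so
-- that it is a genuine total order on the domain).
record System : Set₁ where
  field
    nV      : ℕ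
    dom     : Fin nV → ℕ
    dom>1   : ∀ v → dom v ≥ 2
    Carrier : Set
    _⊕_     : Carrier → Carrier → Carrier
    ⊕-comm  : ∀ x y → x ⊕ y ≡ y ⊕ x
    ⊕-assoc : ∀ x y z → (x ⊕ y) ⊕ z ≡ x ⊕ (y ⊕ z)
    _<_     : Rel Carrier 0ℓ
    <-sto   : IsStrictTotalOrder _≡_ _<_
    val     : (v : Fin nV) → Fin (dom v) → Carrier
    val-inj : ∀ v {a b} → val v a ≡ val v b → a ≡ b

members : ∀ {n} → Subset n → List (Fin n)
members [] = []
members (true ∷ p) = zero ∷ map suc (members p)
members (false ∷ p) = map suc (members p)

module Semantics (S : System) where
  open System S

  Alt : Set
  Alt = (v : Fin nV) → Fin (dom v)

  -- combination ⊕ over a list of variables (nothing for the empty list;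
  -- never used for empty sets since layers are non-empty)
  ⊕over : List (Fin nV) → Alt → Maybe Carrier
  ⊕over [] α = nothing
  ⊕over (y ∷ ys) α with ⊕over ys α
  ... | nothing = just (val y (α y))
  ... | just c  = just (val y (α y) ⊕ c)

  _>M_ : Maybe Carrier → Maybe Carrier → Set
  just a >M just b = b < a
  _ >M _ = ⊥

  Layer : Set
  Layer = Σ (Subset nV) Nonempty

  comb : Layer → Alt → Maybe Carrier
  comb (Y , _) α = ⊕over (members Y) α

  Model : Set
  Model = List⁺ Layer

  AllEq : List Layer → Alt → Alt → Set
  AllEq [] α β = ⊤
  AllEq (Y ∷ Ys) α β = comb Y α ≡ comb Y β × AllEq Ys α β

  LexGt : List Layer → Alt → Alt → Set
  LexGt [] α β = ⊥
  LexGt (Y ∷ Ys) α β = comb Y α >M comb Y β ⊎ (comb Y α ≡ comb Y β × LexGt Ys α β)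

  _⊢_≻_ : Model → Alt → Alt → Set
  π ⊢ α ≻ β = LexGt (L⁺.toList π) α β

  _⊢_≽_ : Model → Alt → Alt → Set
  π ⊢ α ≽ β = AllEq (L⁺.toList π) α β ⊎ LexGt (L⁺.toList π) α β

  data Stmt : Set where
    _≥ₛ_ : Alt → Alt → Stmt
    _>ₛ_ : Alt → Alt → Stmt

  _⊨_ : Model → Stmt → Set
  π ⊨ (α ≥ₛ β) = π ⊢ α ≽ β
  π ⊨ (α >ₛ β) = π ⊢ α ≻ β

  Stmts : Set₁
  Stmts = Pred Stmt 0ℓ

  _⊨S_ : Model → Stmts → Set
  π ⊨S Φ = ∀ φ → Φ φ → π ⊨ φ

  _⊫_ : Stmts → Stmts → Set
  Φ ⊫ Ψ = ∀ π → π ⊨S Φ → π ⊨S Ψ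

  _≋_ : Stmts → Stmts → Set
  Φ ≋ Ψ = (Φ ⊫ Ψ) × (Ψ ⊫ Φ)

  Consistent : Stmts → Set
  Consistent Φ = ∃ λ π → π ⊨S Φ

  Falsifiable : Stmts → Set
  Falsifiable Φ = ∃ λ π → ¬ (π ⊨S Φ)

  NonTrivial : Stmts → Set
  NonTrivial Φ = Consistent Φ × Falsifiable Φ

  ⋃ : ∀ {k} → (Fin k → Stmts) → Stmts
  ⋃ Φs φ = ∃ λ i → Φs i φ

  P1 : Stmts → Set
  P1 Φ = NonTrivial Φ

  P2 : ∀ {k} → (Fin k → Stmts) → Stmts → Set
  P2 Φs Φ = Consistent (⋃ Φs) → Φ ≋ ⋃ Φs

  P3 : ∀ {k} → (Fin k → Stmts) → Stmts → Set
  P3 Φs Φ = ∀ φ → Φ φ → ∀ i φi → Φs i φi → ∃ λ π → (π ⊨ φ) × (π ⊨ φi)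

  P4 : ∀ {k} → (Fin k → Stmts) → Stmts → Set
  P4 Φs Φ = ∀ φ → Φ φ → ∃ λ i → ∀ π → π ⊨S Φs i → π ⊨ φ

  P1-4 : ∀ {k} → (Fin k → Stmts) → Stmts → Set
  P1-4 Φs Φ = P1 Φ × P2 Φs Φ × P3 Φs Φ × P4 Φs Φ

  MiddleGround : ∀ {k} → (Fin k → Stmts) → Stmts → Set₁
  MiddleGround Φs Φ =
    P1-4 Φs Φ ×
    (∀ (Φ' : Stmts) → P1-4 Φs Φ' → Φ' ⊫ Φ → ¬ (Φ ⊫ Φ') → ⊥)

module Submission where

-- Two Boolean variables suffice.  Stakeholder Φ₁ says that raising every
-- variable is an improvement (1 1 > 0 0); stakeholder Φ₂ says that raising a
-- single variable never is (0 0 ≥ 1 0 and 0 0 ≥ 0 1).  These clash, but each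
-- Ψ j = {0 0 ≥ raise j, 1 1 > 0 0} is a compromise: a model of Ψ j has no layer
-- reading j (at the first one, raise j would beat 0 0) and some layer reading
-- the other variable, so it compares alternatives by that other variable alone.
-- All models of Ψ j thus agree on every statement, which makes Ψ j
-- entailment-maximal among consistent candidates; and Ψ 0, Ψ 1 pick different
-- variables, so they are not equivalent.

open import Defs
open import Data.Nat using (ℕ; z≤n; s≤s) renaming (_<_ to _<ℕ_)
open import Data.Nat.Properties using (<-isStrictTotalOrder)
open import Data.Fin using (Fin; zero; suc; toℕ)
open import Data.Fin.Properties using (toℕ-injective)
open import Data.Fin.Subset using (⁅_⁆; ⊤)
open import Data.Fin.Subset.Properties using (x∈⁅x⁆)
open import Data.Bool using (true; false)
open import Data.Vec using ([]; _∷_; here)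
open import Data.List using (List; []; _∷_)
open import Data.List.NonEmpty using (toList) renaming (_∷_ to _∷⁺_)
open import Data.List.Relation.Unary.All using (All; []; _∷_)
open import Data.List.Relation.Unary.Any using (Any; here; there)
open import Data.Maybe using (nothing; just)
open import Data.Maybe.Properties using (just-injective)
open import Data.Product using (Σ; ∃; _×_; _,_)
open import Data.Sum using (_⊎_; inj₁; inj₂)
import Data.Sum as Sum
open import Data.Empty using (⊥-elim)
open import Data.Unit using (tt)
open import Function using (_∘_)
open import Function.Bundles using (_⇔_; mk⇔; Equivalence)
open import Relation.Nullary using (¬_; contradiction)
open import Relation.Unary using (_⊆_)
open import Relation.Binary using (IsStrictTotalOrder)
open import Relation.Binary.PropositionalEquality
  using (_≡_; refl; sym; trans; cong; subst; subst₂)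

module Lexicographic (S : System) where
  open System S
  open Semantics S

  LexGe : List Layer → Alt → Alt → Set
  LexGe L α β = AllEq L α β ⊎ LexGt L α β

  >M-irrefl : ∀ m → ¬ (m >M m)
  >M-irrefl nothing ()
  >M-irrefl (just _) = IsStrictTotalOrder.irrefl <-sto refl

  allEq⇒¬lexGt : ∀ L {α β} → AllEq L α β → ¬ LexGt L α β
  allEq⇒¬lexGt (Y ∷ L) {β = β} (eq , _) (inj₁ gt) =
    >M-irrefl (comb Y β) (subst (_>M comb Y β) eq gt)
  allEq⇒¬lexGt (Y ∷ L) (_ , eqs) (inj₂ (_ , gt)) = allEq⇒¬lexGt L eqs gt

  lexGe-tail : ∀ Y {L α β} → comb Y α ≡ comb Y β → LexGe (Y ∷ L) α β → LexGe L α β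
  lexGe-tail _ _ (inj₁ (_ , eqs)) = inj₁ eqs
  lexGe-tail Y {β = β} eq (inj₂ (inj₁ gt)) =
    ⊥-elim (>M-irrefl (comb Y β) (subst (_>M comb Y β) eq gt))
  lexGe-tail _ _ (inj₂ (inj₂ (_ , gt))) = inj₂ gt

  record Blind (Y : Layer) : Set where
    constructor blindness
    field comb-const : ∀ α β → comb Y α ≡ comb Y β

  record Reads (i : Fin nV) (Y : Layer) : Set where
    constructor reading
    field comb-reads : ∀ α → comb Y α ≡ just (val i (α i))

  open Blind public
  open Reads public

  ReadsAtMost : Fin nV → Layer → Set
  ReadsAtMost i Y = Blind Y ⊎ Reads i Y

  ComparesBy : Fin nV → List Layer → Set
  ComparesBy i L = All (ReadsAtMost i) L × Any (Reads i) L

  _⊨at_ : Fin nV → Stmt → Set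
  i ⊨at (α ≥ₛ β) = α i ≡ β i ⊎ val i (β i) < val i (α i)
  i ⊨at (α >ₛ β) = val i (β i) < val i (α i)

  blind-¬gt : ∀ {Y α β} → Blind Y → ¬ (comb Y α >M comb Y β)
  blind-¬gt {Y} {α} {β} blind gt =
    >M-irrefl (comb Y β) (subst (_>M comb Y β) (comb-const blind α β) gt)

  module _ {i : Fin nV} {Y : Layer} (reads : Reads i Y) {α β : Alt} where

    reads-agree : α i ≡ β i → comb Y α ≡ comb Y β
    reads-agree eq =
      trans (comb-reads reads α) (trans (cong (just ∘ val i) eq) (sym (comb-reads reads β)))

    reads-agree⁻¹ : comb Y α ≡ comb Y β → α i ≡ β i
    reads-agree⁻¹ eq = val-inj i (just-injective
      (trans (sym (comb-reads reads α)) (trans eq (comb-reads reads β))))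

    reads-gt : comb Y α >M comb Y β → val i (β i) < val i (α i)
    reads-gt = subst₂ _>M_ (comb-reads reads α) (comb-reads reads β)

    reads-gt⁻¹ : val i (β i) < val i (α i) → comb Y α >M comb Y β
    reads-gt⁻¹ = subst₂ _>M_ (sym (comb-reads reads α)) (sym (comb-reads reads β))

    reads-head : ∀ {L} → LexGe (Y ∷ L) α β → i ⊨at (α ≥ₛ β)
    reads-head (inj₁ (eq , _)) = inj₁ (reads-agree⁻¹ eq)
    reads-head (inj₂ (inj₁ gt)) = inj₂ (reads-gt gt)
    reads-head (inj₂ (inj₂ (eq , _))) = inj₁ (reads-agree⁻¹ eq)

  module _ {i : Fin nV} {α β : Alt} where

    agree⇒allEq : ∀ {L} → All (ReadsAtMost i) L → α i ≡ β i → AllEq L α β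
    agree⇒allEq [] _ = tt
    agree⇒allEq (inj₁ blind ∷ rs) eq = comb-const blind α β , agree⇒allEq rs eq
    agree⇒allEq (inj₂ reads ∷ rs) eq = reads-agree reads eq , agree⇒allEq rs eq

    allEq⇒agree : ∀ {L} → Any (Reads i) L → AllEq L α β → α i ≡ β i
    allEq⇒agree (here reads) (eq , _) = reads-agree⁻¹ reads eq
    allEq⇒agree (there any) (_ , eqs) = allEq⇒agree any eqs

    -- a tie at a layer reading i ties every later layer as well
    lexGt⇒gt : ∀ {L} → All (ReadsAtMost i) L → LexGt L α β → val i (β i) < val i (α i)
    lexGt⇒gt (inj₁ blind ∷ _) (inj₁ gt) = ⊥-elim (blind-¬gt blind gt)
    lexGt⇒gt (inj₁ _ ∷ rs) (inj₂ (_ , gt)) = lexGt⇒gt rs gt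
    lexGt⇒gt (inj₂ reads ∷ _) (inj₁ gt) = reads-gt reads gt
    lexGt⇒gt {_ ∷ L} (inj₂ reads ∷ rs) (inj₂ (eq , gt)) =
      ⊥-elim (allEq⇒¬lexGt L (agree⇒allEq rs (reads-agree⁻¹ reads eq)) gt)

    lexGt⇒any : ∀ {L} → All (ReadsAtMost i) L → LexGt L α β → Any (Reads i) L
    lexGt⇒any (inj₁ blind ∷ _) (inj₁ gt) = ⊥-elim (blind-¬gt blind gt)
    lexGt⇒any (inj₁ _ ∷ rs) (inj₂ (_ , gt)) = there (lexGt⇒any rs gt)
    lexGt⇒any (inj₂ reads ∷ _) _ = here reads

    gt⇒lexGt : ∀ {L} → All (ReadsAtMost i) L → Any (Reads i) L →
               val i (β i) < val i (α i) → LexGt L α β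
    gt⇒lexGt _ (here reads) lt = inj₁ (reads-gt⁻¹ reads lt)
    gt⇒lexGt (inj₁ blind ∷ rs) (there any) lt =
      inj₂ (comb-const blind α β , gt⇒lexGt rs any lt)
    gt⇒lexGt (inj₂ reads ∷ _) (there _) lt = inj₁ (reads-gt⁻¹ reads lt)

  comparesBy-⊨ : ∀ {i} π → ComparesBy i (toList π) → ∀ φ → (π ⊨ φ) ⇔ (i ⊨at φ)
  comparesBy-⊨ π (all , any) (α ≥ₛ β) =
    mk⇔ (Sum.map (allEq⇒agree any) (lexGt⇒gt all))
        (Sum.map (agree⇒allEq all) (gt⇒lexGt all any))
  comparesBy-⊨ π (all , any) (α >ₛ β) = mk⇔ (lexGt⇒gt all) (gt⇒lexGt all any)

  Complete : Stmts → Set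
  Complete Ψ = ∀ π π' → π ⊨S Ψ → π' ⊨S Ψ → ∀ φ → π ⊨ φ → π' ⊨ φ

  comparesBy⇒complete : ∀ {Ψ i} →
    (∀ π → π ⊨S Ψ → ComparesBy i (toList π)) → Complete Ψ
  comparesBy⇒complete cmp π π' π⊨Ψ π'⊨Ψ φ =
    Equivalence.from (comparesBy-⊨ π' (cmp π' π'⊨Ψ) φ)
    ∘ Equivalence.to (comparesBy-⊨ π (cmp π π⊨Ψ) φ)

  complete⇒maximal : ∀ {Ψ Φ} → Complete Ψ → Consistent Φ → Φ ⊫ Ψ → Ψ ⊫ Φ
  complete⇒maximal complete (π₀ , π₀⊨Φ) Φ⊫Ψ π π⊨Ψ φ φ∈Φ =
    complete π₀ π (Φ⊫Ψ π₀ π₀⊨Φ) π⊨Ψ φ (π₀⊨Φ φ φ∈Φ)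

  PairwiseConsistent : Stmts → Set
  PairwiseConsistent Φ = ∀ φ φ' → Φ φ → Φ φ' → ∃ λ π → π ⊨ φ × π ⊨ φ'

  complete⇒middleGround : ∀ {k} {Φs : Fin k → Stmts} {Ψ} →
    NonTrivial Ψ → ¬ Consistent (⋃ Φs) → PairwiseConsistent (⋃ Φs) →
    Ψ ⊆ ⋃ Φs → Complete Ψ → MiddleGround Φs Ψ
  complete⇒middleGround {Φs = Φs} nonTrivial clash pairwise Ψ⊆⋃ complete =
    (nonTrivial , (λ c → contradiction c clash) , P3-holds , P4-holds) ,
    λ Φ' ((consistent , _) , _) Φ'⊫Ψ Ψ⊭Φ' →
      Ψ⊭Φ' (complete⇒maximal complete consistent Φ'⊫Ψ)
    where
    P3-holds : P3 Φs _
    P3-holds φ φ∈Ψ i φᵢ φᵢ∈Φᵢ = pairwise φ φᵢ (Ψ⊆⋃ φ∈Ψ) (i , φᵢ∈Φᵢ)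

    P4-holds : P4 Φs _
    P4-holds φ φ∈Ψ with Ψ⊆⋃ φ∈Ψ
    ... | i , φ∈Φᵢ = i , λ π π⊨Φᵢ → π⊨Φᵢ φ φ∈Φᵢ

module TwoBits where

  -- ⊕ sends every combination of the two values to 0, so the layer {0, 1} is blind.
  twoBits : System
  twoBits = record
    { nV = 2
    ; dom = λ _ → 2
    ; dom>1 = λ _ → s≤s (s≤s z≤n)
    ; Carrier = ℕ
    ; _⊕_ = λ _ _ → 0
    ; ⊕-comm = λ _ _ → refl
    ; ⊕-assoc = λ _ _ _ → refl
    ; _<_ = _<ℕ_
    ; <-sto = <-isStrictTotalOrder
    ; val = λ _ → toℕ
    ; val-inj = λ _ → toℕ-injective
    }

  open Semantics twoBits
  open Lexicographic twoBits

  Var : Set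
  Var = Fin 2

  other : Var → Var
  other zero = suc zero
  other (suc zero) = zero

  self-or-other : ∀ j k → k ≡ j ⊎ k ≡ other j
  self-or-other zero zero = inj₁ refl
  self-or-other zero (suc zero) = inj₂ refl
  self-or-other (suc zero) zero = inj₂ refl
  self-or-other (suc zero) (suc zero) = inj₁ refl

  𝟘 𝟙 : Alt
  𝟘 _ = zero
  𝟙 _ = suc zero

  raise : Var → Alt
  raise zero zero = suc zero
  raise zero (suc zero) = zero
  raise (suc zero) zero = zero
  raise (suc zero) (suc zero) = suc zero

  raise-other : ∀ j → raise j (other j) ≡ zero
  raise-other zero = refl
  raise-other (suc zero) = refl

  raise-wins : ∀ j → ¬ (j ⊨at (𝟘 ≥ₛ raise j))
  raise-wins zero (inj₁ ())
  raise-wins zero (inj₂ ())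
  raise-wins (suc zero) (inj₁ ())
  raise-wins (suc zero) (inj₂ ())

  classify : ∀ Y → Blind Y ⊎ ∃ λ k → Reads k Y
  classify (true ∷ true ∷ [] , _) = inj₁ (blindness λ _ _ → refl)
  classify (true ∷ false ∷ [] , _) = inj₂ (zero , reading λ _ → refl)
  classify (false ∷ true ∷ [] , _) = inj₂ (suc zero , reading λ _ → refl)
  classify (false ∷ false ∷ [] , _) = inj₁ (blindness λ _ _ → refl)

  singleton : Var → Layer
  singleton i = ⁅ i ⁆ , i , x∈⁅x⁆ i

  singleton-reads : ∀ i → Reads i (singleton i)
  singleton-reads zero = reading λ _ → refl
  singleton-reads (suc zero) = reading λ _ → refl

  focus : Var → Model
  focus i = singleton i ∷⁺ []

  focus-⊨ : ∀ i {φ} → i ⊨at φ → focus i ⊨ φ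
  focus-⊨ i {φ} =
    Equivalence.from (comparesBy-⊨ (focus i) (inj₂ reads ∷ [] , here reads) φ)
    where reads = singleton-reads i

  indifferent : Model
  indifferent = (⊤ , zero , here) ∷⁺ []

  indifferent-⊨≥ : ∀ α β → indifferent ⊨ (α ≥ₛ β)
  indifferent-⊨≥ _ _ = inj₁ (refl , tt)

  indifferent-⊭> : ¬ (indifferent ⊨ (𝟙 >ₛ 𝟘))
  indifferent-⊭> (inj₁ ())
  indifferent-⊭> (inj₂ (_ , ()))

  allRaisedBetter : Stmts
  allRaisedBetter φ = φ ≡ 𝟙 >ₛ 𝟘

  noneRaisedBetter : Stmts
  noneRaisedBetter φ = ∃ λ j → φ ≡ 𝟘 ≥ₛ raise j

  stakeholders : Fin 2 → Stmts
  stakeholders zero = allRaisedBetter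
  stakeholders (suc zero) = noneRaisedBetter

  ignore : Var → Stmts
  ignore j φ = φ ≡ 𝟘 ≥ₛ raise j ⊎ φ ≡ 𝟙 >ₛ 𝟘

  -- at the first layer reading j the raised alternative would win
  ignore⇒readsAtMost : ∀ j L → LexGe L 𝟘 (raise j) → All (ReadsAtMost (other j)) L
  ignore⇒readsAtMost j [] _ = []
  ignore⇒readsAtMost j (Y ∷ L) h with classify Y
  ... | inj₁ blind = inj₁ blind ∷
          ignore⇒readsAtMost j L (lexGe-tail Y (comb-const blind 𝟘 (raise j)) h)
  ... | inj₂ (k , reads) with self-or-other j k
  ...   | inj₁ refl = ⊥-elim (raise-wins j (reads-head reads h))
  ...   | inj₂ refl = inj₂ reads ∷
          ignore⇒readsAtMost j L
            (lexGe-tail Y (reads-agree reads {𝟘} (sym (raise-other j))) h)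

  ignore-comparesBy : ∀ j π → π ⊨S ignore j → ComparesBy (other j) (toList π)
  ignore-comparesBy j π π⊨Ψ = readsAtMost , lexGt⇒any readsAtMost (π⊨Ψ _ (inj₂ refl))
    where readsAtMost = ignore⇒readsAtMost j (toList π) (π⊨Ψ _ (inj₁ refl))

  ignore-rejects : ∀ j π → π ⊨S ignore j → ¬ (π ⊨ (𝟘 ≥ₛ raise (other j)))
  ignore-rejects j π π⊨Ψ =
    raise-wins (other j)
    ∘ Equivalence.to (comparesBy-⊨ π (ignore-comparesBy j π π⊨Ψ) (𝟘 ≥ₛ raise (other j)))

  focus-⊨ignore : ∀ j → focus (other j) ⊨S ignore j
  focus-⊨ignore j _ (inj₁ refl) =
    focus-⊨ (other j) {𝟘 ≥ₛ raise j} (inj₁ (sym (raise-other j)))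
  focus-⊨ignore j _ (inj₂ refl) = focus-⊨ (other j) {𝟙 >ₛ 𝟘} (s≤s z≤n)

  ignore-nonTrivial : ∀ j → NonTrivial (ignore j)
  ignore-nonTrivial j =
    (focus (other j) , focus-⊨ignore j) ,
    (indifferent , λ ⊨Ψ → indifferent-⊭> (⊨Ψ _ (inj₂ refl)))

  stakeholders-nonTrivial : ∀ k → NonTrivial (stakeholders k)
  stakeholders-nonTrivial zero =
    (focus (other zero) , λ { _ refl → focus-⊨ignore zero _ (inj₂ refl) }) ,
    (indifferent , λ ⊨Φ → indifferent-⊭> (⊨Φ _ refl))
  stakeholders-nonTrivial (suc zero) =
    (indifferent , λ { _ (j , refl) → indifferent-⊨≥ 𝟘 (raise j) }) ,
    (focus (other zero) , λ ⊨Φ →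
       ignore-rejects zero _ (focus-⊨ignore zero) (⊨Φ _ (suc zero , refl)))

  ignore⊆stakeholders : ∀ j → ignore j ⊆ ⋃ stakeholders
  ignore⊆stakeholders j (inj₁ refl) = suc zero , j , refl
  ignore⊆stakeholders j (inj₂ refl) = zero , refl

  stakeholders-inconsistent : ¬ Consistent (⋃ stakeholders)
  stakeholders-inconsistent (π , π⊨⋃) =
    ignore-rejects zero π (λ φ → π⊨⋃ φ ∘ ignore⊆stakeholders zero)
      (π⊨⋃ _ (suc zero , suc zero , refl))

  stakeholders-pairwiseConsistent : PairwiseConsistent (⋃ stakeholders)
  stakeholders-pairwiseConsistent _ _ (zero , refl) (zero , refl) =
    focus (other zero) , focus-⊨ignore zero _ (inj₂ refl) , focus-⊨ignore zero _ (inj₂ refl)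
  stakeholders-pairwiseConsistent _ _ (zero , refl) (suc zero , j , refl) =
    focus (other j) , focus-⊨ignore j _ (inj₂ refl) , focus-⊨ignore j _ (inj₁ refl)
  stakeholders-pairwiseConsistent _ _ (suc zero , j , refl) (zero , refl) =
    focus (other j) , focus-⊨ignore j _ (inj₁ refl) , focus-⊨ignore j _ (inj₂ refl)
  stakeholders-pairwiseConsistent _ _ (suc zero , j , refl) (suc zero , j' , refl) =
    indifferent , indifferent-⊨≥ 𝟘 (raise j) , indifferent-⊨≥ 𝟘 (raise j')

  ignore-middleGround : ∀ j → MiddleGround stakeholders (ignore j)
  ignore-middleGround j =
    complete⇒middleGround (ignore-nonTrivial j) stakeholders-inconsistent
      stakeholders-pairwiseConsistent (ignore⊆stakeholders j)
      (comparesBy⇒complete (ignore-comparesBy j))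

  ignore-inequivalent : ¬ (ignore zero ≋ ignore (suc zero))
  ignore-inequivalent (Ψ₀⊫Ψ₁ , _) =
    ignore-rejects zero _ (focus-⊨ignore zero)
      (Ψ₀⊫Ψ₁ _ (focus-⊨ignore zero) _ (inj₁ refl))

open TwoBits
  using ( twoBits; stakeholders; stakeholders-nonTrivial
        ; ignore; ignore-middleGround; ignore-inequivalent )

theorem6 : Σ System λ S → let open Semantics S in
    Σ ℕ λ k → Σ (Fin k → Stmts) λ Φs →
    (∀ i → NonTrivial (Φs i)) ×
    Σ Stmts λ Ψ₁ → Σ Stmts λ Ψ₂ →
    MiddleGround Φs Ψ₁ × MiddleGround Φs Ψ₂ × ¬ (Ψ₁ ≋ Ψ₂)
theorem6 =
  twoBits , 2 , stakeholders , stakeholders-nonTrivial ,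
  ignore zero , ignore (suc zero) ,
  ignore-middleGround zero , ignore-middleGround (suc zero) , ignore-inequivalent
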